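{- Let $a,b$ be positive integers and $\Delta\in\mathrm{CONF}(a,b)$. Then $\Delta$ is regular if and only if every word $w\in\{0,1\}^{a+b}$ associated with $\Delta$ is balanced.
   Context: $\mathrm{CONF}(a,b)$ is the set of necklaces (circular arrangements up to rotation) of $a$ red and $b$ black beads. For $\Delta$ with black beads $B_0,\dots,B_{b-1}$ in cyclic order, its characteristic sequence $\{x_0,\dots,x_{b-1}\}$ lists the number $x_i$ of red beads between $B_i$ and $B_{i+1}$ (indices mod $b$). $\Delta$ is regular if $\frac{a}{b}k-1 < x_i+\dots+x_{i+k-1} < \frac{a}{b}k+1$ for all $0\le i\le b-1$ and $1\le k\le 1+\lfloor b/2\rfloor$ (indices mod $b$). A word $w=w_0\cdots w_{n-1}\in\{0,1\}^n$, with $n=a+b$, is associated with $\Delta$ if placing $w_0,\dots,w_{n-1}$ consecutively around a circle, reading $1$ as a red bead and $0$ as a black bead, yields $\Delta$. The associated words form one orbit under the cyclic shift $\sigma(w_0\cdots w_{n-1})=w_1\cdots w_{n-1}w_0$. For a word $z$, $|z|$ is its length, $|z|_1$ its number of 1s, and $|z|_0=|z|-|z|_1$. A cyclic subword of $w$ is any length-$q$ prefix of some $\sigma^{i}(w)$, with $0\le i<n$ and $1\le q\le n$. The word $w$ is balanced if for any two cyclic subwords $z,z'$ of $w$ with $|z|=|z'|$ we have $||z|_i-|z'|_i|\le 1$ for $i=0,1$. -}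

module Defs where

open import Data.Bool using (Bool; true; false)
open import Data.Nat using (ℕ; zero; suc; _+_; _*_; _∸_; _/_; _%_; _≤_; _<_; NonZero; ∣_-_∣)
open import Data.List using (List; []; _∷_; _++_; [_]; length; take; map; upTo; zipWith)
open import Data.Product using (_×_; Σ)
open import Data.Nat.ListAction using (sum)
open import Function using (_∘_)
open import Relation.Binary.PropositionalEquality using (_≡_)

-- A binary word; true = 1 = red bead, false = 0 = black bead.
Word : Set
Word = List Bool

σ : Word → Word
σ []       = []
σ (x ∷ xs) = xs ++ [ x ]

σ^ : ℕ → Word → Word
σ^ zero    w = w
σ^ (suc i) w = σ (σ^ i w)

ones : Word → ℕ
ones []          = 0
ones (true  ∷ z) = suc (ones z)
ones (false ∷ z) = ones z

zeros : Word → ℕ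
zeros z = length z ∸ ones z

Balanced : Word → Set
Balanced w =
  ∀ i j q → i < length w → j < length w → 1 ≤ q → q ≤ length w →
    (∣ ones (take q (σ^ i w)) - ones (take q (σ^ j w)) ∣ ≤ 1)
    × (∣ zeros (take q (σ^ i w)) - zeros (take q (σ^ j w)) ∣ ≤ 1)

zeroPosFrom : ℕ → Word → List ℕ
zeroPosFrom p []           = []
zeroPosFrom p (true  ∷ w)  = zeroPosFrom (suc p) w
zeroPosFrom p (false ∷ w)  = p ∷ zeroPosFrom (suc p) w

zeroPos : Word → List ℕ
zeroPos = zeroPosFrom 0

-- Characteristic sequence of the necklace represented by w, starting from the
-- black bead at the first 0-position p₀ < p₁ < ⋯ < p_{b-1}:
--   x_i = p_{i+1} - p_i - 1  (i < b-1),   x_{b-1} = (n + p₀) - p_{b-1} - 1.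
charSeq : Word → List ℕ
charSeq w with zeroPos w
... | []       = []
... | (p ∷ ps) = zipWith (λ u v → v ∸ u ∸ 1) (p ∷ ps) (ps ++ [ length w + p ])

-- i-th entry of a list (default 0 out of range)
nth : List ℕ → ℕ → ℕ
nth []       _       = 0
nth (x ∷ xs) zero    = x
nth (x ∷ xs) (suc i) = nth xs i

windowSum : (b : ℕ) → .{{NonZero b}} → List ℕ → ℕ → ℕ → ℕ
windowSum b x i k = sum (map (λ j → nth x ((i + j) % b)) (upTo k))

-- Regularity of a characteristic sequence x = {x₀,…,x_{b-1}}:
--   (a/b)k - 1 < x_i+⋯+x_{i+k-1} < (a/b)k + 1  for 0 ≤ i ≤ b-1, 1 ≤ k ≤ 1 + ⌊b/2⌋,
-- written after multiplying through by b > 0:  a k < b S + b  and  b S < a k + b.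
RegularSeq : (a b : ℕ) → .{{NonZero b}} → List ℕ → Set
RegularSeq a b x =
  ∀ i k → i < b → 1 ≤ k → k ≤ 1 + b / 2 →
    (a * k < b * windowSum b x i k + b) × (b * windowSum b x i k < a * k + b)

-- A word of length a+b with exactly a ones represents a necklace Δ ∈ CONF(a,b).
IsConf : (a b : ℕ) → Word → Set
IsConf a b w = (length w ≡ a + b) × (ones w ≡ a)

Regular : (a b : ℕ) → .{{NonZero b}} → Word → Set
Regular a b w = RegularSeq a b (charSeq w)

Associated : Word → Word → Set
Associated w w' = Σ ℕ (λ i → w' ≡ σ^ i w)

-- Unroll a representative word w of length n = a + b into the n-periodic
-- sequence f t = (σ^t w)₀.  Write zc i q for the number of zeros (black beads)
-- of f in the window [i, i+q) and pos j for the position of the j-th zero of f;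
-- then pos (j + b) = pos j + n, and the gap S defined by
-- pos (j + k) = pos j + k + S counts the ones between the j-th and (j+k)-th
-- zero.  Window sums of the characteristic sequence are exactly these gaps, so
-- regularity says b·|S − (a/b)·k| < b for the gaps with k ≤ 1 + ⌊b/2⌋.
-- The argument for the periodic sequence has three steps:
--   (1) regularity of short gaps extends to all gaps with k < b, using
--       periodicity of pos and complementing a k-gap by a (b−k)-gap;
--   (2) regular gaps ⇒ windows of equal length differ by ≤ 1 in their zeros:
--       a window with c+2 zeros and one with c zeros produce two gaps over
--       c+1 zeros whose lengths differ by at least 2;
--   (3) balanced windows ⇒ regular gaps: the n windows of a fixed length L
--       contain L·b zeros in total, while an irregular gap together with
--       balance would force this total strictly above or below L·b.
-- The file first develops finite sums, least witnesses and the arithmetic of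
-- the regularity inequalities, then zero counts (ZeroCount) and zero positions
-- (PeriodicZeros) of sequences, with steps (1)–(3) in Regularity.  Words,
-- rotations and zeroPos come next; the module Necklace matches them with f,
-- zc and pos (balance of ones follows from balance of zeros, as both add up
-- to the length q), and theorem5 just combines its two directions.
module Submission where

open import Defs
open import Data.Bool using (Bool; true; false)
open import Data.Nat
open import Data.Nat.Properties
open import Data.Nat.DivMod
open import Data.Nat.Tactic.RingSolver using (solve-∀)
open import Data.Nat.ListAction using (sum)
open import Data.List using (List; []; _∷_; _++_; [_]; length; take; zipWith; applyUpTo)
open import Data.List.Properties using (map-upTo; length-++; length-take; take-all; ++-assoc; ++-identityʳ)
open import Data.Product using (_×_; _,_; Σ; proj₁; proj₂)
open import Data.Sum using (_⊎_; inj₁; inj₂)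
open import Data.Empty using (⊥-elim)
open import Relation.Nullary using (¬_; Dec; yes; no)
open import Relation.Binary.PropositionalEquality hiding ([_])

sumTo : (ℕ → ℕ) → ℕ → ℕ
sumTo h zero    = 0
sumTo h (suc m) = sumTo h m + h m

sumTo-cong : ∀ g h m → (∀ i → g i ≡ h i) → sumTo g m ≡ sumTo h m
sumTo-cong g h zero    e = refl
sumTo-cong g h (suc m) e = cong₂ _+_ (sumTo-cong g h m e) (e m)

sumTo-+ : ∀ g h m → sumTo (λ i → g i + h i) m ≡ sumTo g m + sumTo h m
sumTo-+ g h zero    = refl
sumTo-+ g h (suc m) = trans (cong (_+ (g m + h m)) (sumTo-+ g h m))
                            (interchange (sumTo g m) (sumTo h m) (g m) (h m))
  where
  interchange : ∀ x y u v → (x + y) + (u + v) ≡ (x + u) + (y + v)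
  interchange = solve-∀

sumTo-≤ : ∀ h c m → (∀ i → i < m → h i ≤ c) → sumTo h m ≤ m * c
sumTo-≤ h c zero    hb = z≤n
sumTo-≤ h c (suc m) hb = subst (sumTo h m + h m ≤_) (+-comm (m * c) c)
  (+-mono-≤ (sumTo-≤ h c m (λ i lt → hb i (m<n⇒m<1+n lt))) (hb m ≤-refl))

sumTo-≥ : ∀ h c m → (∀ i → i < m → c ≤ h i) → m * c ≤ sumTo h m
sumTo-≥ h c zero    hb = z≤n
sumTo-≥ h c (suc m) hb = subst (_≤ sumTo h m + h m) (+-comm (m * c) c)
  (+-mono-≤ (sumTo-≥ h c m (λ i lt → hb i (m<n⇒m<1+n lt))) (hb m ≤-refl))

sumTo-< : ∀ h c m → (∀ i → i < m → h i ≤ c) → ∀ i₀ → i₀ < m → h i₀ < c → sumTo h m < m * c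
sumTo-< h c (suc m) hb i₀ i₀< lt with m≤n⇒m<n∨m≡n i₀<
... | inj₁ i₀<m = subst (sumTo h m + h m <_) (+-comm (m * c) c)
  (+-mono-<-≤ (sumTo-< h c m (λ i lt → hb i (m<n⇒m<1+n lt)) i₀ (≤-pred i₀<m) lt) (hb m ≤-refl))
... | inj₂ refl = subst (sumTo h m + h m <_) (+-comm (m * c) c)
  (+-mono-≤-< (sumTo-≤ h c m (λ i lt → hb i (m<n⇒m<1+n lt))) lt)

sumTo-> : ∀ h c m → (∀ i → i < m → c ≤ h i) → ∀ i₀ → i₀ < m → c < h i₀ → m * c < sumTo h m
sumTo-> h c (suc m) hb i₀ i₀< lt with m≤n⇒m<n∨m≡n i₀<
... | inj₁ i₀<m = subst (_< sumTo h m + h m) (+-comm (m * c) c)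
  (+-mono-<-≤ (sumTo-> h c m (λ i lt → hb i (m<n⇒m<1+n lt)) i₀ (≤-pred i₀<m) lt) (hb m ≤-refl))
... | inj₂ refl = subst (_< sumTo h m + h m) (+-comm (m * c) c)
  (+-mono-≤-< (sumTo-≥ h c m (λ i lt → hb i (m<n⇒m<1+n lt))) lt)

quasi-periodic : ∀ (g : ℕ → ℕ) n c → (∀ t → g (t + n) ≡ g t + c) →
                 ∀ t m → g (t + m * n) ≡ g t + m * c
quasi-periodic g n c step t zero    = trans (cong g (+-identityʳ t)) (sym (+-identityʳ _))
quasi-periodic g n c step t (suc m) = begin
  g (t + (n + m * n))  ≡⟨ cong g (trans (cong (t +_) (+-comm n (m * n))) (sym (+-assoc t (m * n) n))) ⟩
  g (t + m * n + n)    ≡⟨ step (t + m * n) ⟩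
  g (t + m * n) + c    ≡⟨ cong (_+ c) (quasi-periodic g n c step t m) ⟩
  g t + m * c + c      ≡⟨ trans (+-assoc (g t) (m * c) c) (cong (g t +_) (+-comm (m * c) c)) ⟩
  g t + (c + m * c)    ∎
  where open ≡-Reasoning

LeastWitness : (ℕ → Set) → Set
LeastWitness Q = Σ ℕ (λ t → Q t × (∀ s → s < t → ¬ Q s))

search-least : {Q : ℕ → Set} → (∀ t → Dec (Q t)) → ∀ N → LeastWitness Q ⊎ (∀ s → s ≤ N → ¬ Q s)
search-least Q? zero with Q? 0
... | yes q₀ = inj₁ (0 , q₀ , λ s ())
... | no ¬q₀ = inj₂ λ { zero _ → ¬q₀ }
search-least {Q} Q? (suc N) with search-least Q? N | Q? (suc N)
... | inj₁ w    | _      = inj₁ w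
... | inj₂ none | yes qN = inj₁ (suc N , qN , λ s s<sN → none s (<⇒≤pred s<sN))
... | inj₂ none | no ¬qN = inj₂ λ s s≤sN → up-to-suc (m≤n⇒m<n∨m≡n s≤sN)
  where
  up-to-suc : ∀ {s} → s < suc N ⊎ s ≡ suc N → ¬ Q s
  up-to-suc (inj₁ s<)   = none _ (<⇒≤pred s<)
  up-to-suc (inj₂ refl) = ¬qN

least-witness : {Q : ℕ → Set} → (∀ t → Dec (Q t)) → ∀ N → Q N → LeastWitness Q
least-witness Q? N q with search-least Q? N
... | inj₁ w    = w
... | inj₂ none = ⊥-elim (none N ≤-refl q)

GapRegular : ℕ → ℕ → ℕ → ℕ → Set
GapRegular a b k S = (a * k < b * S + b) × (b * S < a * k + b)

transfer-bound : ∀ {X Y U V c} → X + Y ≡ U + V → V < Y + c → X < U + c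
transfer-bound {X} {Y} {U} {V} {c} eq V<Y+c = +-cancelʳ-< V X (U + c) (begin-strict
  X + V        <⟨ +-monoʳ-< X V<Y+c ⟩
  X + (Y + c)  ≡⟨ sym (+-assoc X Y c) ⟩
  X + Y + c    ≡⟨ cong (_+ c) eq ⟩
  U + V + c    ≡⟨ +-assoc U V c ⟩
  U + (V + c)  ≡⟨ cong (U +_) (+-comm V c) ⟩
  U + (c + V)  ≡⟨ sym (+-assoc U c V) ⟩
  U + c + V    ∎)
  where open ≤-Reasoning

-- If k + k' = b and S + S' = a, then S − (a/b)k = −(S' − (a/b)k'): a gap is
-- regular exactly when its complement in a full period is.
gapRegular-complement : ∀ a b k k' S S' → k + k' ≡ b → S + S' ≡ a →
                        GapRegular a b k' S' → GapRegular a b k S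
gapRegular-complement a b k k' S S' kk SS (lower' , upper') =
  transfer-bound both-ab upper' , transfer-bound (sym both-ab) lower'
  where
  open ≡-Reasoning
  both-ab : a * k + a * k' ≡ b * S + b * S'
  both-ab = begin
    a * k + a * k'  ≡⟨ sym (*-distribˡ-+ a k k') ⟩
    a * (k + k')    ≡⟨ cong (a *_) kk ⟩
    a * b           ≡⟨ *-comm a b ⟩
    b * a           ≡⟨ cong (b *_) (sym SS) ⟩
    b * (S + S')    ≡⟨ *-distribˡ-+ b S S' ⟩
    b * S + b * S'  ∎

gapRegular-period : ∀ a b → 1 ≤ b → GapRegular a b b a
gapRegular-period a b b≥1 rewrite *-comm a b = m<m+n (b * a) b≥1 , m<m+n (b * a) b≥1

-- Zero counts of an infinite binary sequence.

zeroInd : Bool → ℕ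
zeroInd false = 1
zeroInd true  = 0

zeroInd≤1 : ∀ x → zeroInd x ≤ 1
zeroInd≤1 false = ≤-refl
zeroInd≤1 true  = z≤n

module ZeroCount (f : ℕ → Bool) where

  zc : ℕ → ℕ → ℕ
  zc i zero    = 0
  zc i (suc q) = zeroInd (f i) + zc (suc i) q

  zc-+ : ∀ i q r → zc i (q + r) ≡ zc i q + zc (i + q) r
  zc-+ i zero    r = cong (λ u → zc u r) (sym (+-identityʳ i))
  zc-+ i (suc q) r rewrite zc-+ (suc i) q r | +-suc i q = sym (+-assoc (zeroInd (f i)) (zc (suc i) q) _)

  zc-last : ∀ i q → zc i (suc q) ≡ zc i q + zeroInd (f (i + q))
  zc-last i q = trans (cong (zc i) (+-comm 1 q)) (trans (zc-+ i q 1) (cong (zc i q +_) (+-identityʳ _)))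

  zc≤ : ∀ i q → zc i q ≤ q
  zc≤ i zero    = z≤n
  zc≤ i (suc q) = +-mono-≤ (zeroInd≤1 (f i)) (zc≤ (suc i) q)

  zc-monoʳ : ∀ i {q r} → q ≤ r → zc i q ≤ zc i r
  zc-monoʳ i {q} q≤r with m≤n⇒∃[o]m+o≡n q≤r
  ... | o , refl rewrite zc-+ i q o = m≤m+n _ _

  zc-as-sum : ∀ i q → sumTo (λ t → zeroInd (f (t + i))) q ≡ zc i q
  zc-as-sum i zero    = refl
  zc-as-sum i (suc q) = trans (cong₂ _+_ (zc-as-sum i q) (cong (λ u → zeroInd (f u)) (+-comm q i)))
                              (sym (zc-last i q))

  Z : ℕ → ℕ
  Z = zc 0

  Z-split : ∀ i q → Z (i + q) ≡ Z i + zc i q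
  Z-split = zc-+ 0

  Z-mono : ∀ {t u} → t ≤ u → Z t ≤ Z u
  Z-mono = zc-monoʳ 0

  Z-step : ∀ t → Z (suc t) ≤ suc (Z t)
  Z-step t = begin
    Z (suc t)             ≡⟨ zc-last 0 t ⟩
    Z t + zeroInd (f t)   ≤⟨ +-monoʳ-≤ (Z t) (zeroInd≤1 (f t)) ⟩
    Z t + 1               ≡⟨ +-comm (Z t) 1 ⟩
    suc (Z t)             ∎
    where open ≤-Reasoning

module PeriodicZeros (f : ℕ → Bool) (n b : ℕ)
                     (periodic : ∀ t → f (t + n) ≡ f t)
                     (Z-n : ZeroCount.Z f n ≡ b) (b≥1 : 1 ≤ b) where
  open ZeroCount f

  instance
    n-nonZero : NonZero n
    n-nonZero = >-nonZero (≤-trans b≥1 (subst (_≤ n) Z-n (zc≤ 0 n)))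
    b-nonZero : NonZero b
    b-nonZero = >-nonZero b≥1

  zc-shift : ∀ i q → zc (i + n) q ≡ zc i q
  zc-shift i zero    = refl
  zc-shift i (suc q) = cong₂ _+_ (cong zeroInd (periodic i)) (zc-shift (suc i) q)

  zc-period : ∀ i → zc i n ≡ b
  zc-period zero    = Z-n
  zc-period (suc i) = trans (+-cancelˡ-≡ (zeroInd (f i)) _ _ rotate) (zc-period i)
    where
    -- moving the window one step drops f i and adds f (i + n) = f i
    rotate : zeroInd (f i) + zc (suc i) n ≡ zeroInd (f i) + zc i n
    rotate = trans (zc-last i n)
             (trans (cong (λ x → zc i n + zeroInd x) (periodic i)) (+-comm (zc i n) _))

  Z-period : ∀ t → Z (t + n) ≡ Z t + b
  Z-period t = trans (Z-split t n) (cong (Z t +_) (zc-period t))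

  Z-periods : ∀ t m → Z (t + m * n) ≡ Z t + m * b
  Z-periods = quasi-periodic Z n b Z-period

  zc-mod : ∀ i q → zc (i % n) q ≡ zc i q
  zc-mod i q = begin
    zc (i % n) q                   ≡⟨ sym (+-identityʳ _) ⟩
    zc (i % n) q + 0               ≡⟨ cong (zc (i % n) q +_) (*-zeroʳ (i / n)) ⟨
    zc (i % n) q + (i / n) * 0     ≡⟨ quasi-periodic (λ j → zc j q) n 0 (λ j → trans (zc-shift j q) (sym (+-identityʳ _))) (i % n) (i / n) ⟨
    zc (i % n + (i / n) * n) q     ≡⟨ cong (λ j → zc j q) (sym (m≡m%n+[m/n]*n i n)) ⟩
    zc i q                         ∎
    where open ≡-Reasoning

  -- pos j = position of the j-th zero of f (counting from 0): the least t such
  -- that [0, t] contains more than j zeros.  There is one by position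
  -- (j+1)·n, since every period contains b ≥ 1 zeros.
  private
    pos-witness : ∀ j → LeastWitness (λ t → j < Z (suc t))
    pos-witness j = least-witness (λ t → j <? Z (suc t)) (suc j * n) enough
      where
      enough : j < Z (suc (suc j * n))
      enough = begin
        suc j            ≤⟨ m≤m*n (suc j) b ⟩
        suc j * b        ≡⟨ Z-periods 0 (suc j) ⟨
        Z (suc j * n)    ≤⟨ Z-mono (n≤1+n (suc j * n)) ⟩
        Z (suc (suc j * n)) ∎
        where open ≤-Reasoning

  pos : ℕ → ℕ
  pos j = proj₁ (pos-witness j)

  pos<⇒j<Z : ∀ {j t} → pos j < t → j < Z t
  pos<⇒j<Z {j} lt = ≤-trans (proj₁ (proj₂ (pos-witness j))) (Z-mono lt)

  j<Z⇒pos< : ∀ {j} t → j < Z t → pos j < t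
  j<Z⇒pos< zero ()
  j<Z⇒pos< {j} (suc t) lt with pos j ≤? t
  ... | yes le = s≤s le
  ... | no nle = ⊥-elim (proj₂ (proj₂ (pos-witness j)) t (≰⇒> nle) lt)

  Z-pos : ∀ j → Z (pos j) ≡ j
  Z-pos j = ≤-antisym (≮⇒≥ (λ j<Z → <-irrefl refl (j<Z⇒pos< (pos j) j<Z)))
                      (≤-pred (≤-trans (pos<⇒j<Z ≤-refl) (Z-step (pos j))))

  Z-suc-pos : ∀ j → Z (suc (pos j)) ≡ suc j
  Z-suc-pos j = ≤-antisym (subst (λ u → Z (suc (pos j)) ≤ suc u) (Z-pos j) (Z-step (pos j)))
                          (pos<⇒j<Z ≤-refl)

  pos-zero : ∀ j → f (pos j) ≡ false
  pos-zero j with f (pos j) in fj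
  ... | false = refl
  ... | true  = ⊥-elim (<-irrefl refl (begin-strict
    Z (pos j)                     <⟨ n<1+n _ ⟩
    suc (Z (pos j))               ≡⟨ cong suc (Z-pos j) ⟩
    suc j                         ≡⟨ Z-suc-pos j ⟨
    Z (suc (pos j))               ≡⟨ zc-last 0 (pos j) ⟩
    Z (pos j) + zeroInd (f (pos j)) ≡⟨ cong (λ x → Z (pos j) + zeroInd x) fj ⟩
    Z (pos j) + 0                 ≡⟨ +-identityʳ _ ⟩
    Z (pos j)                     ∎))
    where open ≤-Reasoning

  pos-unique : ∀ {j t} → f t ≡ false → Z t ≡ j → pos j ≡ t
  pos-unique {j} {t} ft Zt = ≤-antisym (≤-pred (j<Z⇒pos< (suc t) j<Zst))
                                      (≮⇒≥ (λ pos<t → <-irrefl (sym Zt) (pos<⇒j<Z pos<t)))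
    where
    j<Zst : j < Z (suc t)
    j<Zst = subst (j <_) (sym (trans (zc-last 0 t) (cong₂ (λ u x → u + zeroInd x) Zt ft)))
                  (subst (j <_) (+-comm 1 j) ≤-refl)

  pos-< : ∀ {j j'} → j < j' → pos j < pos j'
  pos-< {j' = j'} lt = j<Z⇒pos< (pos j') (subst (_ <_) (sym (Z-pos j')) lt)

  pos-+ : ∀ j k → pos j + k ≤ pos (j + k)
  pos-+ j zero    = ≤-reflexive (trans (+-identityʳ _) (cong pos (sym (+-identityʳ j))))
  pos-+ j (suc k) = begin
    pos j + suc k       ≡⟨ +-suc (pos j) k ⟩
    suc (pos j + k)     ≤⟨ s≤s (pos-+ j k) ⟩
    suc (pos (j + k))   ≤⟨ pos-< (n<1+n (j + k)) ⟩
    pos (suc (j + k))   ≡⟨ cong pos (sym (+-suc j k)) ⟩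
    pos (j + suc k)     ∎
    where open ≤-Reasoning

  pos-period : ∀ j → pos (j + b) ≡ pos j + n
  pos-period j = pos-unique (trans (periodic (pos j)) (pos-zero j))
                            (trans (Z-period (pos j)) (cong (_+ b) (Z-pos j)))

  pos-periods : ∀ j m → pos (j + m * b) ≡ pos j + m * n
  pos-periods = quasi-periodic pos b n pos-period

  -- IsGap j k S: exactly S ones lie between the j-th and the (j+k)-th zero
  IsGap : ℕ → ℕ → ℕ → Set
  IsGap j k S = pos (j + k) ≡ pos j + k + S

  gap-exists : ∀ j k → IsGap j k (pos (j + k) ∸ (pos j + k))
  gap-exists j k = sym (m+[n∸m]≡n (pos-+ j k))

  window-from-zero : ∀ {j k S} → IsGap j k S → zc (pos j) (suc (S + k)) ≡ suc k
  window-from-zero {j} {k} {S} gap = +-cancelˡ-≡ j _ _ (begin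
    j + zc (pos j) (suc (S + k))           ≡⟨ cong (_+ zc (pos j) (suc (S + k))) (Z-pos j) ⟨
    Z (pos j) + zc (pos j) (suc (S + k))   ≡⟨ Z-split (pos j) (suc (S + k)) ⟨
    Z (pos j + suc (S + k))                ≡⟨ cong Z (trans (rearrange (pos j) S k) (cong suc (sym gap))) ⟩
    Z (suc (pos (j + k)))                  ≡⟨ Z-suc-pos (j + k) ⟩
    suc (j + k)                            ≡⟨ +-suc j k ⟨
    j + suc k                              ∎)
    where
    open ≡-Reasoning
    rearrange : ∀ p S k → p + suc (S + k) ≡ suc (p + k + S)
    rearrange = solve-∀

  window-after-zero : ∀ {j k S} → IsGap j (suc k) S → zc (suc (pos j)) (S + k) ≡ k
  window-after-zero {j} {k} {S} gap = +-cancelˡ-≡ (suc j) _ _ (begin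
    suc j + zc (suc (pos j)) (S + k)               ≡⟨ cong (_+ zc (suc (pos j)) (S + k)) (Z-suc-pos j) ⟨
    Z (suc (pos j)) + zc (suc (pos j)) (S + k)     ≡⟨ Z-split (suc (pos j)) (S + k) ⟨
    Z (suc (pos j) + (S + k))                      ≡⟨ cong Z (trans (rearrange (pos j) S k) (sym gap)) ⟩
    Z (pos (j + suc k))                            ≡⟨ Z-pos (j + suc k) ⟩
    j + suc k                                      ≡⟨ +-suc j k ⟩
    suc j + k                                      ∎)
    where
    open ≡-Reasoning
    rearrange : ∀ p S k → suc p + (S + k) ≡ p + suc k + S
    rearrange = solve-∀

  pos-sum-of-gaps : ∀ k i (g : ℕ → ℕ) → (∀ t → g t ≡ pos (suc (i + t)) ∸ pos (i + t) ∸ 1) →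
                    pos i + k + sum (applyUpTo g k) ≡ pos (i + k)
  pos-sum-of-gaps zero i g gaps = trans (+-identityʳ _) (trans (+-identityʳ _) (cong pos (sym (+-identityʳ i))))
  pos-sum-of-gaps (suc k) i g gaps = begin
    pos i + suc k + (g 0 + rest)        ≡⟨ rearrange (pos i) k (g 0) rest ⟩
    pos i + 1 + g 0 + k + rest          ≡⟨ cong (λ u → u + k + rest) first-gap ⟩
    pos (suc i) + k + rest              ≡⟨ pos-sum-of-gaps k (suc i) (λ t → g (suc t)) gaps-from-next ⟩
    pos (suc i + k)                     ≡⟨ cong pos (sym (+-suc i k)) ⟩
    pos (i + suc k)                     ∎
    where
    open ≡-Reasoning
    rest = sum (applyUpTo (λ t → g (suc t)) k)
    rearrange : ∀ p k g r → p + suc k + (g + r) ≡ p + 1 + g + k + r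
    rearrange = solve-∀
    gaps-from-next : ∀ t → g (suc t) ≡ pos (suc (suc i + t)) ∸ pos (suc i + t) ∸ 1
    gaps-from-next t = trans (gaps (suc t)) (cong (λ u → pos (suc u) ∸ pos u ∸ 1) (+-suc i t))
    first-gap : pos i + 1 + g 0 ≡ pos (suc i)
    first-gap = begin
      pos i + 1 + g 0                            ≡⟨ cong (pos i + 1 +_) (trans (gaps 0) (cong (λ u → pos (suc u) ∸ pos u ∸ 1) (+-identityʳ i))) ⟩
      pos i + 1 + (pos (suc i) ∸ pos i ∸ 1)      ≡⟨ cong (pos i + 1 +_) (∸-+-assoc (pos (suc i)) (pos i) 1) ⟩
      pos i + 1 + (pos (suc i) ∸ (pos i + 1))    ≡⟨ m+[n∸m]≡n (subst (_≤ pos (suc i)) (+-comm 1 (pos i)) (pos-< (n<1+n i))) ⟩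
      pos (suc i)                                ∎

  module Regularity (a : ℕ) (n≡a+b : n ≡ a + b) where

    RegularAt : ℕ → ℕ → Set
    RegularAt j k = ∀ S → IsGap j k S → GapRegular a b k S

    WindowBalanced : Set
    WindowBalanced = ∀ i j q → q ≤ n → zc i q ≤ zc j q + 1

    -- A window [h, h+q) with at least c+2 zeros contains the zeros number
    -- r, …, r+c+1 where r = Z h, so the gap from zero r over c+1 zeros is short.
    heavy-window : ∀ h q c → suc (suc c) ≤ zc h q →
                   ∀ S → IsGap (Z h) (suc c) S → suc c + S < q
    heavy-window h q c heavy S gap = +-cancelˡ-< (pos r) _ _ (begin-strict
      pos r + (suc c + S)   ≡⟨ sym (+-assoc (pos r) (suc c) S) ⟩
      pos r + suc c + S     ≡⟨ sym gap ⟩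
      pos (r + suc c)       <⟨ j<Z⇒pos< (h + q) last-inside ⟩
      h + q                 ≤⟨ +-monoˡ-≤ q h≤pos ⟩
      pos r + q             ∎)
      where
      open ≤-Reasoning
      r = Z h
      last-inside : r + suc c < Z (h + q)
      last-inside = subst (r + suc c <_) (sym (Z-split h q))
                      (subst (_≤ r + zc h q) (+-suc r (suc c)) (+-monoʳ-≤ r heavy))
      h≤pos : h ≤ pos r
      h≤pos = ≮⇒≥ (λ pos<h → <-irrefl refl (pos<⇒j<Z pos<h))

    -- If [l, l+q) has exactly c zeros and zero number s' precedes l, then the
    -- zeros s' and s'+c+1 enclose the window, so that gap is long.
    light-window : ∀ l q c → zc l q ≡ c → ∀ s' → suc s' ≡ Z l →
                   ∀ S → IsGap s' (suc c) S → q < suc c + S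
    light-window l q c light s' s'<l S gap = +-cancelˡ-< (pos s') _ _ (begin-strict
      pos s' + q            <⟨ +-monoˡ-< q (j<Z⇒pos< l (subst (s' <_) s'<l ≤-refl)) ⟩
      l + q                 ≤⟨ enclosed ⟩
      pos (s' + suc c)      ≡⟨ gap ⟩
      pos s' + suc c + S    ≡⟨ +-assoc (pos s') (suc c) S ⟩
      pos s' + (suc c + S)  ∎)
      where
      open ≤-Reasoning
      zeros-up-to-end : Z (l + q) ≡ s' + suc c
      zeros-up-to-end = trans (Z-split l q) (trans (cong₂ _+_ (sym s'<l) light) (sym (+-suc s' c)))
      enclosed : l + q ≤ pos (s' + suc c)
      enclosed = ≮⇒≥ (λ lt → <-irrefl (sym zeros-up-to-end) (pos<⇒j<Z lt))

    -- Were zc i q ≥ c + 2 with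
    -- c = zc j q, the gaps over c+1 zeros from the heavy and light windows
    -- would differ by at least 2, contradicting their regularity.
    balanced-of-regular : (∀ j k → 1 ≤ k → k < b → RegularAt j k) → WindowBalanced
    balanced-of-regular regular i j q q≤n with zc i q ≤? zc j q + 1
    ... | yes le = le
    ... | no nle = ⊥-elim (<-irrefl refl (<-≤-trans (<-trans long-bound short-bound) gaps-apart))
      where
      c = zc j q
      k = suc c
      heavy : suc (suc c) ≤ zc i q
      heavy = subst (λ u → suc u ≤ zc i q) (+-comm c 1) (≰⇒> nle)
      k<b : k < b
      k<b = ≤-trans heavy (≤-trans (zc-monoʳ i q≤n) (≤-reflexive (zc-period i)))
      r = Z i
      S₁ = pos (r + k) ∸ (pos r + k)
      s' = Z j + (b ∸ 1)
      -- the window at j + n has the same count, and zero s' precedes it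
      s'<j+n : suc s' ≡ Z (j + n)
      s'<j+n = trans (sym (+-suc (Z j) (b ∸ 1)))
                     (trans (cong (Z j +_) (m+[n∸m]≡n b≥1)) (sym (Z-period j)))
      S₂ = pos (s' + k) ∸ (pos s' + k)
      S₁+2≤S₂ : S₁ + 2 ≤ S₂
      S₁+2≤S₂ = +-cancelˡ-≤ k _ _ (subst (_≤ k + S₂) (rearrange k S₁)
                  (≤-trans (s≤s (heavy-window i q c heavy S₁ (gap-exists r k)))
                           (light-window (j + n) q c (zc-shift j q) s' s'<j+n S₂ (gap-exists s' k))))
        where
        rearrange : ∀ k S → suc (suc (k + S)) ≡ k + (S + 2)
        rearrange = solve-∀
      long-bound : b * S₂ < a * k + b
      long-bound = proj₂ (regular s' k (s≤s z≤n) k<b S₂ (gap-exists s' k))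
      short-bound : a * k + b < b * S₁ + b + b
      short-bound = +-monoˡ-< b (proj₁ (regular r k (s≤s z≤n) k<b S₁ (gap-exists r k)))
      gaps-apart : b * S₁ + b + b ≤ b * S₂
      gaps-apart = subst (_≤ b * S₂) (expand b S₁) (*-monoʳ-≤ b S₁+2≤S₂)
        where
        expand : ∀ b S → b * (S + 2) ≡ b * S + b + b
        expand = solve-∀

    -- Double counting: the n windows of length L contain L·b zeros in total,
    -- since every letter lies in exactly L of them.
    zeros-in-all-windows : ∀ L → sumTo (λ i → zc i L) n ≡ L * b
    zeros-in-all-windows zero    = sum-zeros n
      where
      sum-zeros : ∀ m → sumTo (λ _ → 0) m ≡ 0
      sum-zeros zero    = refl
      sum-zeros (suc m) = cong (_+ 0) (sum-zeros m)
    zeros-in-all-windows (suc L) = begin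
      sumTo (λ i → zc i (suc L)) n                                  ≡⟨ sumTo-cong _ _ n (λ i → zc-last i L) ⟩
      sumTo (λ i → zc i L + zeroInd (f (i + L))) n                  ≡⟨ sumTo-+ (λ i → zc i L) (λ i → zeroInd (f (i + L))) n ⟩
      sumTo (λ i → zc i L) n + sumTo (λ i → zeroInd (f (i + L))) n  ≡⟨ cong₂ _+_ (zeros-in-all-windows L) (trans (zc-as-sum L n) (zc-period L)) ⟩
      L * b + b                                                     ≡⟨ +-comm (L * b) b ⟩
      b + L * b                                                     ∎
      where open ≡-Reasoning

    -- Step (3), lower bound.  Otherwise the window from zero j to zero j+k
    -- holds k+1 zeros while balance gives every window of its length ≥ k
    -- zeros, so the total exceeds L·b.
    gap-lower : WindowBalanced → ∀ j k S → IsGap j k S → S + k < n → a * k < b * S + b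
    gap-lower balanced j k S gap S+k<n with a * k <? b * S + b
    ... | yes lower = lower
    ... | no ¬lower = ⊥-elim (<-irrefl refl (<-≤-trans too-many too-few))
      where
      L = suc (S + k)
      at-least-k : ∀ i → i < n → k ≤ zc i L
      at-least-k i _ = ≤-pred (subst₂ _≤_ (window-from-zero gap) (+-comm (zc i L) 1)
                                 (balanced (pos j) i L S+k<n))
      too-many : n * k < L * b
      too-many = subst (n * k <_) (zeros-in-all-windows L)
        (sumTo-> (λ i → zc i L) k n at-least-k (pos j % n) (m%n<n (pos j) n)
          (subst (k <_) (trans (sym (window-from-zero gap)) (sym (zc-mod (pos j) L))) ≤-refl))
      too-few : L * b ≤ n * k
      too-few = begin
        L * b              ≡⟨ expand S k b ⟩
        b * S + b + b * k  ≤⟨ +-monoˡ-≤ (b * k) (≮⇒≥ ¬lower) ⟩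
        a * k + b * k      ≡⟨ *-distribʳ-+ k a b ⟨
        (a + b) * k        ≡⟨ cong (_* k) n≡a+b ⟨
        n * k              ∎
        where
        open ≤-Reasoning
        expand : ∀ S k b → suc (S + k) * b ≡ b * S + b + b * k
        expand = solve-∀

    -- Step (3), upper bound.  Otherwise the window strictly between zero j and
    -- zero j+k holds k−1 zeros while every window of its length holds ≤ k,
    -- so the total falls short of L·b.
    gap-upper : WindowBalanced → ∀ j k S → IsGap j (suc k) S → S + suc k ≤ n → b * S < a * suc k + b
    gap-upper balanced j k S gap S+k≤n with b * S <? a * suc k + b
    ... | yes upper = upper
    ... | no ¬upper = ⊥-elim (<-irrefl refl (<-≤-trans too-few too-many))
      where
      L = S + k
      at-most-k+1 : ∀ i → i < n → zc i L ≤ suc k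
      at-most-k+1 i _ = subst (zc i L ≤_) (trans (cong (_+ 1) (window-after-zero gap)) (+-comm k 1))
                          (balanced i (suc (pos j)) L (≤-trans (+-monoʳ-≤ S (n≤1+n k)) S+k≤n))
      too-few : L * b < n * suc k
      too-few = subst (_< n * suc k) (zeros-in-all-windows L)
        (sumTo-< (λ i → zc i L) (suc k) n at-most-k+1 (suc (pos j) % n) (m%n<n (suc (pos j)) n)
          (subst (_< suc k) (trans (sym (window-after-zero gap)) (sym (zc-mod (suc (pos j)) L))) ≤-refl))
      too-many : n * suc k ≤ L * b
      too-many = begin
        n * suc k                  ≡⟨ cong (_* suc k) n≡a+b ⟩
        (a + b) * suc k            ≡⟨ expand a b k ⟩
        a * suc k + b + b * k      ≤⟨ +-monoˡ-≤ (b * k) (≮⇒≥ ¬upper) ⟩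
        b * S + b * k              ≡⟨ *-distribˡ-+ b S k ⟨
        b * (S + k)                ≡⟨ *-comm b L ⟩
        L * b                      ∎
        where
        open ≤-Reasoning
        expand : ∀ a b k → (a + b) * suc k ≡ a * suc k + b + b * k
        expand = solve-∀

    -- Step (3): balanced windows make every gap over 1 ≤ k ≤ b zeros regular;
    -- a gap over b zeros is a full period and has exactly a ones.
    regular-of-balanced : WindowBalanced → ∀ j k → 1 ≤ k → k ≤ b → RegularAt j k
    regular-of-balanced balanced j (suc k) _ k≤b S gap with m≤n⇒m<n∨m≡n k≤b
    ... | inj₁ k<b = gap-lower balanced j (suc k) S gap shorter-than-period
                   , gap-upper balanced j k S gap (<⇒≤ shorter-than-period)
      where
      shorter-than-period : S + suc k < n
      shorter-than-period = subst (_< n) (+-comm (suc k) S) (+-cancelˡ-< (pos j) _ _ (begin-strict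
        pos j + (suc k + S)  ≡⟨ +-assoc (pos j) (suc k) S ⟨
        pos j + suc k + S    ≡⟨ gap ⟨
        pos (j + suc k)      <⟨ pos-< (+-monoʳ-< j k<b) ⟩
        pos (j + b)          ≡⟨ pos-period j ⟩
        pos j + n            ∎))
        where open ≤-Reasoning
    ... | inj₂ k+1≡b = subst₂ (GapRegular a b) (sym k+1≡b) (sym S≡a) (gapRegular-period a b b≥1)
      where
      one-period : n ≡ suc k + S
      one-period = +-cancelˡ-≡ (pos j) _ _ (begin
        pos j + n            ≡⟨ pos-period j ⟨
        pos (j + b)          ≡⟨ cong (λ m → pos (j + m)) k+1≡b ⟨
        pos (j + suc k)      ≡⟨ gap ⟩
        pos j + suc k + S    ≡⟨ +-assoc (pos j) (suc k) S ⟩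
        pos j + (suc k + S)  ∎)
        where open ≡-Reasoning
      S≡a : S ≡ a
      S≡a = +-cancelˡ-≡ b S a (trans (cong (_+ S) (sym k+1≡b))
                                     (trans (sym one-period) (trans n≡a+b (+-comm a b))))

    regularAt-mod : ∀ j k → RegularAt (j % b) k → RegularAt j k
    regularAt-mod j k regular S gap = regular S (+-cancelʳ-≡ (m * n) _ _ shifted)
      where
      open ≡-Reasoning
      m = j / b
      i = j % b
      j≡i+mb : j ≡ i + m * b
      j≡i+mb = m≡m%n+[m/n]*n j b
      swap : ∀ x y z → x + y + z ≡ x + z + y
      swap = solve-∀
      shifted : pos (i + k) + m * n ≡ pos i + k + S + m * n
      shifted = begin
        pos (i + k) + m * n        ≡⟨ pos-periods (i + k) m ⟨
        pos (i + k + m * b)        ≡⟨ cong pos (trans (swap i k (m * b)) (cong (_+ k) (sym j≡i+mb))) ⟩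
        pos (j + k)                ≡⟨ gap ⟩
        pos j + k + S              ≡⟨ cong (λ u → pos u + k + S) j≡i+mb ⟩
        pos (i + m * b) + k + S    ≡⟨ cong (λ u → u + k + S) (pos-periods i m) ⟩
        pos i + m * n + k + S      ≡⟨ rearrange (pos i) (m * n) k S ⟩
        pos i + k + S + m * n      ∎
        where
        rearrange : ∀ p x k S → p + x + k + S ≡ p + k + S + x
        rearrange = solve-∀

    -- a gap over k zeros together with the following gap over k' = b − k zeros
    -- spans one period, so it holds S + S' = a ones and the complement applies
    regularAt-complement : ∀ j k k' → k + k' ≡ b → RegularAt (j + k) k' → RegularAt j k
    regularAt-complement j k k' k+k'≡b regular S gap =
      gapRegular-complement a b k k' S S' k+k'≡b S+S'≡a (regular S' gap')
      where
      open ≡-Reasoning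
      S' = pos (j + k + k') ∸ (pos (j + k) + k')
      gap' = gap-exists (j + k) k'
      one-period : pos j + ((S + S') + b) ≡ pos j + (a + b)
      one-period = begin
        pos j + ((S + S') + b)           ≡⟨ cong (λ u → pos j + ((S + S') + u)) k+k'≡b ⟨
        pos j + ((S + S') + (k + k'))    ≡⟨ rearrange (pos j) k S k' S' ⟨
        pos j + k + S + k' + S'          ≡⟨ cong (λ u → u + k' + S') gap ⟨
        pos (j + k) + k' + S'            ≡⟨ gap' ⟨
        pos (j + k + k')                 ≡⟨ cong pos (trans (+-assoc j k k') (cong (j +_) k+k'≡b)) ⟩
        pos (j + b)                      ≡⟨ pos-period j ⟩
        pos j + n                        ≡⟨ cong (pos j +_) n≡a+b ⟩
        pos j + (a + b)                  ∎
        where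
        rearrange : ∀ p k S k' S' → p + k + S + k' + S' ≡ p + ((S + S') + (k + k'))
        rearrange = solve-∀
      S+S'≡a : S + S' ≡ a
      S+S'≡a = +-cancelʳ-≡ b _ _ (+-cancelˡ-≡ (pos j) _ _ one-period)

    complement-short : ∀ k → k < b → ¬ (k ≤ 1 + b / 2) → b ∸ k ≤ 1 + b / 2
    complement-short k k<b long = +-cancelˡ-≤ k _ _ (begin
      k + (b ∸ k)           ≡⟨ m+[n∸m]≡n (<⇒≤ k<b) ⟩
      b                     ≡⟨ m≡m%n+[m/n]*n b 2 ⟩
      b % 2 + b / 2 * 2     ≤⟨ +-monoˡ-≤ (b / 2 * 2) (≤-pred (m%n<n b 2)) ⟩
      1 + b / 2 * 2         ≡⟨ cong suc (double (b / 2)) ⟩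
      1 + (b / 2 + b / 2)   ≤⟨ s≤s (+-monoˡ-≤ (b / 2) (≤-trans (n≤1+n _) (≤-trans (n≤1+n _) (≰⇒> long)))) ⟩
      1 + (k + b / 2)       ≡⟨ cong suc (+-comm k _) ⟩
      1 + (b / 2 + k)       ≡⟨ +-comm (1 + b / 2) k ⟩
      k + (1 + b / 2)       ∎)
      where
      open ≤-Reasoning
      double : ∀ x → x * 2 ≡ x + x
      double = solve-∀

    regular-all : (∀ i k → i < b → 1 ≤ k → k ≤ 1 + b / 2 → RegularAt i k) →
                  ∀ j k → 1 ≤ k → k < b → RegularAt j k
    regular-all regular j k 1≤k k<b with k ≤? 1 + b / 2
    ... | yes short = regularAt-mod j k (regular (j % b) k (m%n<n j b) 1≤k short)
    ... | no long   = regularAt-complement j k (b ∸ k) (m+[n∸m]≡n (<⇒≤ k<b))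
                        (regularAt-mod (j + k) (b ∸ k)
                          (regular ((j + k) % b) (b ∸ k) (m%n<n (j + k) b) (m<n⇒0<n∸m k<b)
                                   (complement-short k k<b long)))

    -- A list whose entries, indexed mod b, are the gaps between consecutive
    -- zeros: its window sums are gaps, so its regularity is gap regularity.
    module CharacteristicSequence (x : List ℕ)
             (x-gaps : ∀ t → nth x (t % b) ≡ pos (suc t) ∸ pos t ∸ 1) where

      windowSum-isGap : ∀ i k → IsGap i k (windowSum b x i k)
      windowSum-isGap i k = sym (trans (cong (λ u → pos i + k + sum u) (map-upTo (λ t → nth x ((i + t) % b)) k))
                                       (pos-sum-of-gaps k i (λ t → nth x ((i + t) % b)) (λ t → x-gaps (i + t))))

      regularAt-of-regularSeq : RegularSeq a b x →
                                ∀ i k → i < b → 1 ≤ k → k ≤ 1 + b / 2 → RegularAt i k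
      regularAt-of-regularSeq regular i k i<b 1≤k short S gap =
        subst (GapRegular a b k) same-gap (regular i k i<b 1≤k short)
        where
        same-gap : windowSum b x i k ≡ S
        same-gap = +-cancelˡ-≡ (pos i + k) _ _ (trans (sym (windowSum-isGap i k)) gap)

      regularSeq-of-regularAt : (∀ i k → i < b → 1 ≤ k → k ≤ 1 + b / 2 → RegularAt i k) →
                                RegularSeq a b x
      regularSeq-of-regularAt regular i k i<b 1≤k short =
        regular i k i<b 1≤k short (windowSum b x i k) (windowSum-isGap i k)

-- the s-th letter of a word (padding with ones past its end)
letter : Word → ℕ → Bool
letter []      _       = true
letter (x ∷ u) zero    = x
letter (x ∷ u) (suc s) = letter u s

zeroCount : Word → ℕ
zeroCount []      = 0
zeroCount (x ∷ u) = zeroInd x + zeroCount u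

ones+zeroCount : ∀ u → ones u + zeroCount u ≡ length u
ones+zeroCount []          = refl
ones+zeroCount (true ∷ u)  = cong suc (ones+zeroCount u)
ones+zeroCount (false ∷ u) = trans (+-suc (ones u) (zeroCount u)) (cong suc (ones+zeroCount u))

zeros≡zeroCount : ∀ u → zeros u ≡ zeroCount u
zeros≡zeroCount u = trans (cong (_∸ ones u) (sym (ones+zeroCount u))) (m+n∸m≡n (ones u) (zeroCount u))

zeroCount-prefix : ∀ (g : ℕ → Bool) i q u → q ≤ length u → (∀ s → s < q → letter u s ≡ g (i + s)) →
                   zeroCount (take q u) ≡ ZeroCount.zc g i q
zeroCount-prefix g i zero    u       le agree = refl
zeroCount-prefix g i (suc q) (x ∷ u) (s≤s le) agree =
  cong₂ _+_ (cong zeroInd (trans (agree 0 (s≤s z≤n)) (cong g (+-identityʳ i))))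
            (zeroCount-prefix g (suc i) q u le (λ s lt → trans (agree (suc s) (s≤s lt)) (cong g (+-suc i s))))

length-σ : ∀ u → length (σ u) ≡ length u
length-σ []      = refl
length-σ (x ∷ u) = trans (length-++ u) (+-comm (length u) 1)

length-σ^ : ∀ k u → length (σ^ k u) ≡ length u
length-σ^ zero    u = refl
length-σ^ (suc k) u = trans (length-σ (σ^ k u)) (length-σ^ k u)

σ^-+ : ∀ i j u → σ^ (i + j) u ≡ σ^ i (σ^ j u)
σ^-+ zero    j u = refl
σ^-+ (suc i) j u = cong σ (σ^-+ i j u)

σ^-suc : ∀ k u → σ^ (suc k) u ≡ σ^ k (σ u)
σ^-suc k u = trans (cong (λ m → σ^ m u) (+-comm 1 k)) (σ^-+ k 1 u)

σ^-++ : ∀ u v → σ^ (length u) (u ++ v) ≡ v ++ u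
σ^-++ []      v = sym (++-identityʳ v)
σ^-++ (x ∷ u) v = begin
  σ^ (suc (length u)) (x ∷ (u ++ v))  ≡⟨ σ^-suc (length u) (x ∷ (u ++ v)) ⟩
  σ^ (length u) ((u ++ v) ++ [ x ])    ≡⟨ cong (σ^ (length u)) (++-assoc u v [ x ]) ⟩
  σ^ (length u) (u ++ (v ++ [ x ]))    ≡⟨ σ^-++ u (v ++ [ x ]) ⟩
  (v ++ [ x ]) ++ u                    ≡⟨ ++-assoc v [ x ] u ⟩
  v ++ (x ∷ u)                         ∎
  where open ≡-Reasoning

σ^-length : ∀ u → σ^ (length u) u ≡ u
σ^-length u = trans (cong (σ^ (length u)) (sym (++-identityʳ u))) (σ^-++ u [])

letter-σ : ∀ u s → suc s < length u → letter (σ u) s ≡ letter u (suc s)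
letter-σ (x ∷ [])    zero    (s≤s ())
letter-σ (x ∷ y ∷ u) zero    lt       = refl
letter-σ (x ∷ y ∷ u) (suc s) (s≤s lt) = letter-σ (x ∷ u) s lt

letter-σ^ : ∀ s u → s < length u → letter u s ≡ letter (σ^ s u) 0
letter-σ^ zero    u lt = refl
letter-σ^ (suc s) u lt = begin
  letter u (suc s)          ≡⟨ letter-σ u s lt ⟨
  letter (σ u) s            ≡⟨ letter-σ^ s (σ u) (subst (s <_) (sym (length-σ u)) (<-trans (n<1+n s) lt)) ⟩
  letter (σ^ s (σ u)) 0     ≡⟨ cong (λ v → letter v 0) (σ^-suc s u) ⟨
  letter (σ^ (suc s) u) 0   ∎
  where open ≡-Reasoning

length-zeroPosFrom : ∀ p u → length (zeroPosFrom p u) ≡ zeroCount u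
length-zeroPosFrom p []          = refl
length-zeroPosFrom p (true ∷ u)  = length-zeroPosFrom (suc p) u
length-zeroPosFrom p (false ∷ u) = cong suc (length-zeroPosFrom (suc p) u)

zeroPosFrom-spec : ∀ p u m → m < length (zeroPosFrom p u) →
  Σ ℕ λ d → (nth (zeroPosFrom p u) m ≡ p + d) × d < length u × letter u d ≡ false × zeroCount (take d u) ≡ m
zeroPosFrom-spec p (true ∷ u) m lt with zeroPosFrom-spec (suc p) u m lt
... | d , at , d< , zero-at , before = suc d , trans at (sym (+-suc p d)) , s≤s d< , zero-at , before
zeroPosFrom-spec p (false ∷ u) zero lt = 0 , sym (+-identityʳ p) , s≤s z≤n , refl , refl
zeroPosFrom-spec p (false ∷ u) (suc m) (s≤s lt) with zeroPosFrom-spec (suc p) u m lt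
... | d , at , d< , zero-at , before = suc d , trans at (sym (+-suc p d)) , s≤s d< , zero-at , cong suc before

nth-zipWith : ∀ (g : ℕ → ℕ → ℕ) xs ys m → m < length xs → m < length ys →
              nth (zipWith g xs ys) m ≡ g (nth xs m) (nth ys m)
nth-zipWith g (x ∷ xs) (y ∷ ys) zero    _        _        = refl
nth-zipWith g (x ∷ xs) (y ∷ ys) (suc m) (s≤s l₁) (s≤s l₂) = nth-zipWith g xs ys m l₁ l₂

nth-++-< : ∀ (ps : List ℕ) y m → m < length ps → nth (ps ++ [ y ]) m ≡ nth ps m
nth-++-< (p ∷ ps) y zero    _        = refl
nth-++-< (p ∷ ps) y (suc m) (s≤s lt) = nth-++-< ps y m lt

nth-++-last : ∀ (ps : List ℕ) y → nth (ps ++ [ y ]) (length ps) ≡ y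
nth-++-last []       y = refl
nth-++-last (p ∷ ps) y = nth-++-last ps y

∣-∣≤1-intro : ∀ x y → x ≤ y + 1 → y ≤ x + 1 → ∣ x - y ∣ ≤ 1
∣-∣≤1-intro zero    y       h₁        h₂        = h₂
∣-∣≤1-intro (suc x) zero    h₁        h₂        = h₁
∣-∣≤1-intro (suc x) (suc y) (s≤s h₁) (s≤s h₂) = ∣-∣≤1-intro x y h₁ h₂

∣-∣≤1-elim : ∀ x y → ∣ x - y ∣ ≤ 1 → x ≤ y + 1
∣-∣≤1-elim x y h = ≤-trans (m≤n+∣m-n∣ x y) (+-monoʳ-≤ y h)

ones-bound : ∀ {O₁ Z₁ O₂ Z₂ q} → O₁ + Z₁ ≡ q → O₂ + Z₂ ≡ q → Z₂ ≤ Z₁ + 1 → O₁ ≤ O₂ + 1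
ones-bound {O₁} {Z₁} {O₂} {Z₂} e₁ e₂ le = +-cancelʳ-≤ Z₁ _ _ (begin
  O₁ + Z₁        ≡⟨ trans e₁ (sym e₂) ⟩
  O₂ + Z₂        ≤⟨ +-monoʳ-≤ O₂ le ⟩
  O₂ + (Z₁ + 1)  ≡⟨ cong (O₂ +_) (+-comm Z₁ 1) ⟩
  O₂ + (1 + Z₁)  ≡⟨ +-assoc O₂ 1 Z₁ ⟨
  O₂ + 1 + Z₁    ∎)
  where open ≤-Reasoning

module Necklace (a b : ℕ) .{{_ : NonZero b}} (w : Word)
                (length-w : length w ≡ a + b) (ones-w : ones w ≡ a) where

  n : ℕ
  n = length w

  f : ℕ → Bool
  f t = letter (σ^ t w) 0

  open ZeroCount f

  periodic : ∀ t → f (t + n) ≡ f t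
  periodic t = cong (λ v → letter v 0) (trans (σ^-+ t n w) (cong (σ^ t) (σ^-length w)))

  zeroCount-subword : ∀ r q → q ≤ n → zeroCount (take q (σ^ r w)) ≡ zc r q
  zeroCount-subword r q q≤n = zeroCount-prefix f r q (σ^ r w) (subst (q ≤_) (sym (length-σ^ r w)) q≤n) agree
    where
    agree : ∀ s → s < q → letter (σ^ r w) s ≡ f (r + s)
    agree s s<q = trans (letter-σ^ s (σ^ r w) (subst (s <_) (sym (length-σ^ r w)) (<-≤-trans s<q q≤n)))
                        (cong (λ v → letter v 0) (trans (sym (σ^-+ s r w)) (cong (λ m → σ^ m w) (+-comm s r))))

  zeroCount-w : zeroCount w ≡ b
  zeroCount-w = +-cancelˡ-≡ a _ _ (trans (cong (_+ zeroCount w) (sym ones-w)) (trans (ones+zeroCount w) length-w))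

  Z-n : Z n ≡ b
  Z-n = trans (sym (zeroCount-subword 0 n ≤-refl)) (trans (cong zeroCount (take-all n w ≤-refl)) zeroCount-w)

  b≥1 : 1 ≤ b
  b≥1 = >-nonZero⁻¹ b

  open PeriodicZeros f n b periodic Z-n b≥1
  open Regularity a length-w

  length-zeroPos : length (zeroPos w) ≡ b
  length-zeroPos = trans (length-zeroPosFrom 0 w) zeroCount-w

  zeroPos≡pos : ∀ m → m < b → nth (zeroPos w) m ≡ pos m
  zeroPos≡pos m m<b with zeroPosFrom-spec 0 w m (subst (m <_) (sym length-zeroPos) m<b)
  ... | d , at , d<n , zero-at , before = trans at (sym (pos-unique f-d Z-d))
    where
    f-d : f d ≡ false
    f-d = trans (sym (letter-σ^ d w d<n)) zero-at
    Z-d : Z d ≡ m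
    Z-d = trans (sym (zeroCount-subword 0 d (<⇒≤ d<n))) before

  charSeq-gap : ∀ m → m < b → nth (charSeq w) m ≡ pos (suc m) ∸ pos m ∸ 1
  charSeq-gap m m<b with zeroPos w in eq
  ... | []     = ⊥-elim (n≮0 (<-≤-trans m<b (≤-reflexive (trans (sym length-zeroPos) (cong length eq)))))
  ... | p ∷ ps = begin
      nth (zipWith gapOf (p ∷ ps) (ps ++ [ n + p ])) m   ≡⟨ nth-zipWith gapOf (p ∷ ps) (ps ++ [ n + p ]) m m<len m<len' ⟩
      gapOf (nth (p ∷ ps) m) (nth (ps ++ [ n + p ]) m)  ≡⟨ cong₂ gapOf (zeroPos≡pos' m m<b) next ⟩
      gapOf (pos m) (pos (suc m))                       ∎
    where
    open ≡-Reasoning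
    gapOf : ℕ → ℕ → ℕ
    gapOf u v = v ∸ u ∸ 1
    length-ps : suc (length ps) ≡ b
    length-ps = trans (cong length (sym eq)) length-zeroPos
    zeroPos≡pos' : ∀ i → i < b → nth (p ∷ ps) i ≡ pos i
    zeroPos≡pos' i lt = trans (cong (λ L → nth L i) (sym eq)) (zeroPos≡pos i lt)
    m<len : m < length (p ∷ ps)
    m<len = subst (m <_) (sym length-ps) m<b
    m<len' : m < length (ps ++ [ n + p ])
    m<len' = subst (m <_) (sym (trans (trans (length-++ ps) (+-comm (length ps) 1)) length-ps)) m<b
    -- the zero following the last one is the first zero of the next period
    next : nth (ps ++ [ n + p ]) m ≡ pos (suc m)
    next with m≤n⇒m<n∨m≡n (≤-pred (subst (suc m ≤_) (sym length-ps) m<b))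
    ... | inj₁ lt   = trans (nth-++-< ps (n + p) m lt) (zeroPos≡pos' (suc m) (subst (suc m <_) length-ps (s≤s lt)))
    ... | inj₂ refl = begin
        nth (ps ++ [ n + p ]) (length ps)  ≡⟨ nth-++-last ps (n + p) ⟩
        n + p                              ≡⟨ cong (n +_) (zeroPos≡pos' 0 b≥1) ⟩
        n + pos 0                          ≡⟨ +-comm n (pos 0) ⟩
        pos 0 + n                          ≡⟨ pos-period 0 ⟨
        pos b                              ≡⟨ cong pos (sym length-ps) ⟩
        pos (suc (length ps))              ∎

  charSeq-gaps : ∀ t → nth (charSeq w) (t % b) ≡ pos (suc t) ∸ pos t ∸ 1
  charSeq-gaps t = begin
    nth (charSeq w) i                                ≡⟨ charSeq-gap i (m%n<n t b) ⟩
    pos (suc i) ∸ pos i ∸ 1                          ≡⟨ cong (_∸ 1) ([m+n]∸[m+o]≡n∸o (c * n) (pos (suc i)) (pos i)) ⟨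
    (c * n + pos (suc i)) ∸ (c * n + pos i) ∸ 1      ≡⟨ cong₂ (λ u v → u ∸ v ∸ 1) (trans (+-comm (c * n) _) (sym shift-suc))
                                                                                 (trans (+-comm (c * n) _) (sym shift)) ⟩
    pos (suc t) ∸ pos t ∸ 1                          ∎
    where
    open ≡-Reasoning
    i = t % b
    c = t / b
    t≡i+cb : t ≡ i + c * b
    t≡i+cb = m≡m%n+[m/n]*n t b
    shift : pos t ≡ pos i + c * n
    shift = trans (cong pos t≡i+cb) (pos-periods i c)
    shift-suc : pos (suc t) ≡ pos (suc i) + c * n
    shift-suc = trans (cong (λ u → pos (suc u)) t≡i+cb) (pos-periods (suc i) c)

  zeros-subword : ∀ r q → q ≤ n → zeros (take q (σ^ r w)) ≡ zc r q
  zeros-subword r q q≤n = trans (zeros≡zeroCount (take q (σ^ r w))) (zeroCount-subword r q q≤n)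

  ones+zeros-subword : ∀ r q → q ≤ n → ones (take q (σ^ r w)) + zc r q ≡ q
  ones+zeros-subword r q q≤n = begin
    ones (take q (σ^ r w)) + zc r q                          ≡⟨ cong (ones (take q (σ^ r w)) +_) (zeroCount-subword r q q≤n) ⟨
    ones (take q (σ^ r w)) + zeroCount (take q (σ^ r w))     ≡⟨ ones+zeroCount (take q (σ^ r w)) ⟩
    length (take q (σ^ r w))                                 ≡⟨ length-take q (σ^ r w) ⟩
    q ⊓ length (σ^ r w)                                      ≡⟨ m≤n⇒m⊓n≡m (subst (q ≤_) (sym (length-σ^ r w)) q≤n) ⟩
    q                                                        ∎
    where open ≡-Reasoning

  -- balanced windows of f make every rotation of w balanced: the subwords
  -- of σ^k w are windows of f, and ones are balanced because ones + zeros = q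
  balanced-of-windowBalanced : WindowBalanced → ∀ k → Balanced (σ^ k w)
  balanced-of-windowBalanced balanced k i j q _ _ _ q≤len rewrite sym (σ^-+ i k w) | sym (σ^-+ j k w) =
    ∣-∣≤1-intro O₁ O₂ (ones-bound (ones+zeros-subword r₁ q q≤n) (ones+zeros-subword r₂ q q≤n) (balanced r₂ r₁ q q≤n))
                      (ones-bound (ones+zeros-subword r₂ q q≤n) (ones+zeros-subword r₁ q q≤n) (balanced r₁ r₂ q q≤n)) ,
    subst₂ (λ u v → ∣ u - v ∣ ≤ 1) (sym (zeros-subword r₁ q q≤n)) (sym (zeros-subword r₂ q q≤n))
      (∣-∣≤1-intro (zc r₁ q) (zc r₂ q) (balanced r₁ r₂ q q≤n) (balanced r₂ r₁ q q≤n))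
    where
    q≤n : q ≤ n
    q≤n = subst (q ≤_) (length-σ^ k w) q≤len
    r₁ = i + k
    r₂ = j + k
    O₁ = ones (take q (σ^ r₁ w))
    O₂ = ones (take q (σ^ r₂ w))

  windowBalanced-of-balanced : Balanced w → WindowBalanced
  windowBalanced-of-balanced balanced i j zero    q≤n = z≤n
  windowBalanced-of-balanced balanced i j (suc q) q≤n =
    subst₂ (λ u v → u ≤ v + 1) (trans (zeros-subword (i % n) (suc q) q≤n) (zc-mod i (suc q)))
                               (trans (zeros-subword (j % n) (suc q) q≤n) (zc-mod j (suc q)))
      (∣-∣≤1-elim _ _ (proj₂ (balanced (i % n) (j % n) (suc q) (m%n<n i n) (m%n<n j n) (s≤s z≤n) q≤n)))

  open CharacteristicSequence (charSeq w) charSeq-gaps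

  regular⇒balanced : Regular a b w → (w' : Word) → Associated w w' → Balanced w'
  regular⇒balanced regular w' (k , w'≡σ^kw) =
    subst Balanced (sym w'≡σ^kw)
      (balanced-of-windowBalanced (balanced-of-regular (regular-all (regularAt-of-regularSeq regular))) k)

  balanced⇒regular : ((w' : Word) → Associated w w' → Balanced w') → Regular a b w
  balanced⇒regular balanced = regularSeq-of-regularAt λ i k i<b 1≤k short →
    regular-of-balanced (windowBalanced-of-balanced (balanced w (0 , refl))) i k 1≤k
                        (≤-trans short (m/n<m b 2 (s≤s (s≤s z≤n))))

theorem5 : (a b : ℕ) → .{{_ : NonZero a}} → .{{_ : NonZero b}} → (w : Word) → IsConf a b w →
    (Regular a b w → ((w' : Word) → Associated w w' → Balanced w'))
    × (((w' : Word) → Associated w w' → Balanced w') → Regular a b w)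
theorem5 a b w (length-w , ones-w) = regular⇒balanced , balanced⇒regular
  where open Necklace a b w length-w ones-w
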